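{- $\mathrm{ex}'(n,\{\text{nested},\text{ears},\text{david}\})\in O(n)$.
   Context: Let $P$ be a set of $n$ points in convex position in the plane (the vertices of a convex $n$-gon); a triangle on $P$ is a 3-element subset of $P$. For two distinct triangles $t_1,t_2$ on $P$, label each point of $t_1\cup t_2$ by the triangle(s) containing it and read the points in their cyclic order around the polygon. The pair forms exactly one of eight configurations. (i) If $t_1,t_2$ share two vertices $u,v$: "taco" if their third vertices lie on the same side of the line $uv$, "mariposa" if on opposite sides. (ii) If they share exactly one vertex $v$: read the remaining four vertices in cyclic order starting just after $v$; "bat" if the pattern is $t_1t_1t_2t_2$ or $t_2t_2t_1t_1$, "nested" if it is $t_1t_2t_2t_1$ or $t_2t_1t_1t_2$, "crossing" if it is $t_1t_2t_1t_2$ or $t_2t_1t_2t_1$. (iii) If they share no vertex, the cyclic sequence of the six labels is, up to rotation, reflection and exchanging the roles of $t_1,t_2$, one of: "ears" $AAABBB$, "swords" $AABABB$, "david" $ABABAB$. Top/bottom variant: partition the vertices of the convex $n$-gon by a horizontal line into a top half of $\lceil n/2\rceil$ vertices and a bottom half of $\lfloor n/2\rfloor$ vertices (each half consisting of consecutive vertices along the polygon). For a set $X$ of configurations, $\mathrm{ex}'(n,X)$ is the maximum size of a family of triangles on $P$, each having exactly two vertices in the top half and one vertex in the bottom half, in which no two triangles form a configuration belonging to $X$. -}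

module Defs where

open import Data.Nat using (ℕ; zero; suc; _<_; _≤_; _*_; ⌈_/2⌉)
open import Data.Nat.Properties using (_≟_)
open import Data.Bool using (Bool; true; false; _∨_)
open import Data.List using (List; []; _∷_; _++_; drop; take; map; reverse; upTo; length)
open import Data.Product using (_×_; ∃-syntax; _,_)
open import Data.Sum using (_⊎_)
open import Data.Empty using (⊥)
open import Relation.Nullary using (¬_)
open import Relation.Nullary.Decidable using (⌊_⌋)
open import Relation.Binary.PropositionalEquality using (_≡_; _≢_)
open import Data.List.Membership.Propositional using (_∈_)
open import Data.List.Relation.Unary.All using (All)
open import Data.List.Relation.Unary.Unique.Propositional using (Unique)

-- The convex n-gon has vertices 0,1,…,n-1 in cyclic order.
-- A triangle is a 3-subset, represented canonically as (a , b , c) with a < b < c < n.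
Tri : Set
Tri = ℕ × ℕ × ℕ

IsTri : ℕ → Tri → Set
IsTri n (a , b , c) = a < b × b < c × c < n

InTop : ℕ → ℕ → Set
InTop n x = x < ⌈ n /2⌉

InBottom : ℕ → ℕ → Set
InBottom n x = ⌈ n /2⌉ ≤ x

-- A top/bottom triangle: exactly two vertices in the top half, one in the bottom half.
-- For a < b < c this means a, b in the top half and c in the bottom half.
TopBottomTri : ℕ → Tri → Set
TopBottomTri n t@(a , b , c) = IsTri n t × InTop n a × InTop n b × InBottom n c

_∈ᵗ_ : ℕ → Tri → Bool
x ∈ᵗ (a , b , c) = ⌊ x ≟ a ⌋ ∨ ⌊ x ≟ b ⌋ ∨ ⌊ x ≟ c ⌋

-- labels: in t₁ only (L₁), in t₂ only (L₂), in both (L₁₂)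
data Lab : Set where
  L₁ L₂ L₁₂ : Lab

labelsFrom : Tri → Tri → List ℕ → List Lab
labelsFrom t₁ t₂ [] = []
labelsFrom t₁ t₂ (x ∷ xs) with x ∈ᵗ t₁ | x ∈ᵗ t₂
... | true  | true  = L₁₂ ∷ labelsFrom t₁ t₂ xs
... | true  | false = L₁ ∷ labelsFrom t₁ t₂ xs
... | false | true  = L₂ ∷ labelsFrom t₁ t₂ xs
... | false | false = labelsFrom t₁ t₂ xs

labels : ℕ → Tri → Tri → List Lab
labels n t₁ t₂ = labelsFrom t₁ t₂ (upTo n)

rotate : {A : Set} → ℕ → List A → List A
rotate k xs = drop k xs ++ take k xs

-- Nested: one shared vertex v; the remaining four, read cyclically starting
-- just after v, have pattern t₁t₂t₂t₁ or t₂t₁t₁t₂.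
Nested : ℕ → Tri → Tri → Set
Nested n t₁ t₂ = ∃[ k ] (rotate k (labels n t₁ t₂) ≡ L₁₂ ∷ L₁ ∷ L₂ ∷ L₂ ∷ L₁ ∷ []
                       ⊎ rotate k (labels n t₁ t₂) ≡ L₁₂ ∷ L₂ ∷ L₁ ∷ L₁ ∷ L₂ ∷ [])

swapLab : Lab → Lab
swapLab L₁ = L₂
swapLab L₂ = L₁
swapLab L₁₂ = L₁₂

CyclicallyEquiv : List Lab → List Lab → Set
CyclicallyEquiv s p = ∃[ k ] (rotate k s ≡ p ⊎ rotate k (reverse s) ≡ p
                            ⊎ rotate k (map swapLab s) ≡ p
                            ⊎ rotate k (reverse (map swapLab s)) ≡ p)

Ears : ℕ → Tri → Tri → Set
Ears n t₁ t₂ = CyclicallyEquiv (labels n t₁ t₂) (L₁ ∷ L₁ ∷ L₁ ∷ L₂ ∷ L₂ ∷ L₂ ∷ [])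

David : ℕ → Tri → Tri → Set
David n t₁ t₂ = CyclicallyEquiv (labels n t₁ t₂) (L₁ ∷ L₂ ∷ L₁ ∷ L₂ ∷ L₁ ∷ L₂ ∷ [])

Forbidden : ℕ → Tri → Tri → Set
Forbidden n t₁ t₂ = Nested n t₁ t₂ ⊎ Ears n t₁ t₂ ⊎ David n t₁ t₂

Admissible : ℕ → List Tri → Set
Admissible n F = Unique F × All (TopBottomTri n) F
               × (∀ {t₁ t₂} → t₁ ∈ F → t₂ ∈ F → t₁ ≢ t₂ → ¬ Forbidden n t₁ t₂)

-- Write a triangle as (a , b , c) with a < b in the top half and c in the bottom
-- half.
--
-- The main argument splits an admissible family F into three classes.  Call a
-- triangle inner if F contains triangles on the same top pair (a , b) with both a
-- lower and a higher bottom vertex.  Inner triangles are counted by their bottom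
-- vertex c, outer triangles that cannot be extended (no triangle of F starts at a
-- with a later second vertex) by the pair (has-lower-neighbour, a), and the
-- remaining outer triangles by (has-lower-neighbour, b).  In each case the
-- forbidden configurations leave at most two triangles per key, giving
-- 2n + 4n + 4n = 10n.
module Submission where

open import Defs
open import Data.Nat using (ℕ; _≤_; _*_)
open import Data.List using (List; length)
open import Data.Product using (∃-syntax)

open import Data.Nat using (zero; suc; _+_; _<_; z≤n; s≤s)
open import Data.Nat.Properties
open import Data.Nat.Solver using (module +-*-Solver)
open import Data.Bool using (Bool; true; false; _∨_)
open import Data.List using ([]; _∷_; _++_; _∷ʳ_; upTo; filter)
open import Data.List.Properties using (upTo-∷ʳ; ++-identityʳ)
open import Data.List.Relation.Unary.All as All using (_∷_)
open import Data.List.Relation.Unary.AllPairs using (_∷_)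
open import Data.List.Relation.Unary.Linked using (Linked; [-]; _∷_; tail)
open import Data.List.Membership.Propositional using (_∈_; find; lose)
open import Data.List.Membership.Propositional.Properties using (∈-filter⁻)
open import Data.List.Relation.Unary.Unique.Propositional using (Unique)
import Data.List.Relation.Unary.Unique.Propositional.Properties as Unique
open import Data.List.Relation.Unary.Any using (any?; here; there)
open import Data.Product using (_×_; _,_; proj₁; proj₂)
open import Data.Sum using (_⊎_; inj₁; inj₂)
open import Data.Empty using (⊥; ⊥-elim)
open import Function using (_∘_)
open import Level using (0ℓ)
open import Relation.Nullary using (¬_; Dec; yes; no; ¬?)
open import Relation.Nullary.Decidable using (⌊_⌋; _×-dec_; map′; isYes≗does; dec-true; dec-false)
open import Relation.Unary using (Pred; Decidable)
open import Relation.Binary.PropositionalEquality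
open import Relation.Binary.Definitions using (tri<; tri≈; tri>)

⌊⌋-true : ∀ {A : Set} (a? : Dec A) → A → ⌊ a? ⌋ ≡ true
⌊⌋-true a? a = trans (isYes≗does a?) (dec-true a? a)

⌊⌋-false : ∀ {A : Set} (a? : Dec A) → ¬ A → ⌊ a? ⌋ ≡ false
⌊⌋-false a? ¬a = trans (isYes≗does a?) (dec-false a? ¬a)

⌊⌋-cong : ∀ {A B : Set} (a? : Dec A) (b? : Dec B) → (A → B) → (B → A) → ⌊ a? ⌋ ≡ ⌊ b? ⌋
⌊⌋-cong a? b? f g with a? | b?
... | yes _ | yes _ = refl
... | no _  | no _  = refl
... | yes a | no ¬b = ⊥-elim (¬b (f a))
... | no ¬a | yes b = ⊥-elim (¬a (g b))

labelsFrom-++ : ∀ t₁ t₂ xs ys → labelsFrom t₁ t₂ (xs ++ ys) ≡ labelsFrom t₁ t₂ xs ++ labelsFrom t₁ t₂ ys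
labelsFrom-++ t₁ t₂ [] ys = refl
labelsFrom-++ t₁ t₂ (x ∷ xs) ys with x ∈ᵗ t₁ | x ∈ᵗ t₂
... | true  | true  = cong (L₁₂ ∷_) (labelsFrom-++ t₁ t₂ xs ys)
... | true  | false = cong (L₁ ∷_) (labelsFrom-++ t₁ t₂ xs ys)
... | false | true  = cong (L₂ ∷_) (labelsFrom-++ t₁ t₂ xs ys)
... | false | false = labelsFrom-++ t₁ t₂ xs ys

labelsFrom-point : ∀ s₁ s₂ t₁ t₂ y z → y ∈ᵗ s₁ ≡ z ∈ᵗ t₁ → y ∈ᵗ s₂ ≡ z ∈ᵗ t₂
                 → labelsFrom s₁ s₂ (y ∷ []) ≡ labelsFrom t₁ t₂ (z ∷ [])
labelsFrom-point s₁ s₂ t₁ t₂ y z e₁ e₂ with y ∈ᵗ s₁ | y ∈ᵗ s₂ | z ∈ᵗ t₁ | z ∈ᵗ t₂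
labelsFrom-point _ _ _ _ _ _ refl refl | true  | true  | _ | _ = refl
labelsFrom-point _ _ _ _ _ _ refl refl | true  | false | _ | _ = refl
labelsFrom-point _ _ _ _ _ _ refl refl | false | true  | _ | _ = refl
labelsFrom-point _ _ _ _ _ _ refl refl | false | false | _ | _ = refl

labelsFrom-outside : ∀ t₁ t₂ y → y ∈ᵗ t₁ ≡ false → y ∈ᵗ t₂ ≡ false → labelsFrom t₁ t₂ (y ∷ []) ≡ []
labelsFrom-outside t₁ t₂ y e₁ e₂ with y ∈ᵗ t₁ | y ∈ᵗ t₂
labelsFrom-outside _ _ _ refl refl | false | false = refl

mapT : (ℕ → ℕ) → Tri → Tri
mapT x (a , b , c) = x a , x b , x c

StrictlyIncreasing : (ℕ → ℕ) → Set
StrictlyIncreasing x = ∀ i → x i < x (suc i)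

-- Relabelling the vertices along a strictly increasing map x preserves labels.
module Relabel (x : ℕ → ℕ) (increasing : StrictlyIncreasing x) where

  mono-< : ∀ {i j} → i < j → x i < x j
  mono-< {i} {suc j} (s≤s i≤j) with m≤n⇒m<n∨m≡n i≤j
  ... | inj₁ i<j  = <-trans (mono-< i<j) (increasing j)
  ... | inj₂ refl = increasing j

  mono-≤ : ∀ {i j} → i ≤ j → x i ≤ x j
  mono-≤ i≤j with m≤n⇒m<n∨m≡n i≤j
  ... | inj₁ i<j  = <⇒≤ (mono-< i<j)
  ... | inj₂ refl = ≤-refl

  injective : ∀ {i j} → x i ≡ x j → i ≡ j
  injective {i} {j} e with <-cmp i j
  ... | tri< i<j _ _ = ⊥-elim (<⇒≢ (mono-< i<j) e)
  ... | tri≈ _ i≡j _ = i≡j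
  ... | tri> _ _ j<i = ⊥-elim (<⇒≢ (mono-< j<i) (sym e))

  ∈ᵗ-image : ∀ j T → x j ∈ᵗ mapT x T ≡ j ∈ᵗ T
  ∈ᵗ-image j (p , q , r) = cong₂ _∨_ (same p) (cong₂ _∨_ (same q) (same r))
    where
    same : ∀ i → ⌊ x j ≟ x i ⌋ ≡ ⌊ j ≟ i ⌋
    same i = ⌊⌋-cong (x j ≟ x i) (j ≟ i) injective (cong x)

  ∈ᵗ-outside : ∀ m T → (∀ i → m ≢ x i) → m ∈ᵗ mapT x T ≡ false
  ∈ᵗ-outside m (p , q , r) m∉x =
    cong₂ _∨_ (⌊⌋-false (m ≟ x p) (m∉x p))
              (cong₂ _∨_ (⌊⌋-false (m ≟ x q) (m∉x q)) (⌊⌋-false (m ≟ x r) (m∉x r)))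

  skipped : ∀ m k → (∀ i → i < k → x i < m) → (∀ i → k ≤ i → suc m ≤ x i) → ∀ i → m ≢ x i
  skipped m k below above i refl with i <? k
  ... | yes i<k = <-irrefl refl (below i i<k)
  ... | no  i≮k = <-irrefl refl (above i (≮⇒≥ i≮k))

  labels-image : ∀ T₁ T₂ m k → (∀ i → i < k → x i < m) → (∀ i → k ≤ i → m ≤ x i)
               → labelsFrom (mapT x T₁) (mapT x T₂) (upTo m) ≡ labelsFrom T₁ T₂ (upTo k)
  labels-image T₁ T₂ zero zero _ _ = refl
  labels-image T₁ T₂ zero (suc k) below _ = ⊥-elim (n≮0 (below 0 (s≤s z≤n)))
  labels-image T₁ T₂ (suc m) k below above = begin
      X (upTo (suc m))          ≡⟨ cong X (sym (upTo-∷ʳ m)) ⟩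
      X (upTo m ∷ʳ m)           ≡⟨ labelsFrom-++ _ _ (upTo m) (m ∷ []) ⟩
      X (upTo m) ++ X (m ∷ [])  ≡⟨ last-point k below above ⟩
      labelsFrom T₁ T₂ (upTo k) ∎
    where
    open ≡-Reasoning
    X : List ℕ → List Lab
    X = labelsFrom (mapT x T₁) (mapT x T₂)

    gap : ∀ k → (∀ i → i < k → x i < m) → (∀ i → k ≤ i → suc m ≤ x i) → X (m ∷ []) ≡ []
    gap k below above = labelsFrom-outside _ _ m (∈ᵗ-outside m T₁ m∉x) (∈ᵗ-outside m T₂ m∉x)
      where
      m∉x : ∀ i → m ≢ x i
      m∉x = skipped m k below above

    last-point : ∀ k → (∀ i → i < k → x i < suc m) → (∀ i → k ≤ i → suc m ≤ x i)
               → X (upTo m) ++ X (m ∷ []) ≡ labelsFrom T₁ T₂ (upTo k)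
    last-point zero _ above =
      cong₂ _++_ (labels-image T₁ T₂ m zero (λ _ ()) (λ i _ → <⇒≤ (above i z≤n)))
                 (gap zero (λ _ ()) above)
    last-point (suc k) below above with m≤n⇒m<n∨m≡n (≤-pred (below k ≤-refl))
    ... | inj₁ xk<m =
      trans (cong₂ _++_ (labels-image T₁ T₂ m (suc k) below′ (λ i k<i → <⇒≤ (above i k<i)))
                        (gap (suc k) below′ above))
            (++-identityʳ _)
      where
      below′ : ∀ i → i < suc k → x i < m
      below′ i i≤k = ≤-<-trans (mono-≤ (≤-pred i≤k)) xk<m
    ... | inj₂ xk≡m = begin
      X (upTo m) ++ X (m ∷ [])                                ≡⟨ cong₂ _++_ earlier point ⟩
      labelsFrom T₁ T₂ (upTo k) ++ labelsFrom T₁ T₂ (k ∷ [])  ≡⟨ sym (labelsFrom-++ T₁ T₂ (upTo k) (k ∷ [])) ⟩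
      labelsFrom T₁ T₂ (upTo k ∷ʳ k)                          ≡⟨ cong (labelsFrom T₁ T₂) (upTo-∷ʳ k) ⟩
      labelsFrom T₁ T₂ (upTo (suc k))                         ∎
      where
      earlier : X (upTo m) ≡ labelsFrom T₁ T₂ (upTo k)
      earlier = labels-image T₁ T₂ m k (λ i i<k → subst (x i <_) xk≡m (mono-< i<k))
                                       (λ i k≤i → subst (_≤ x i) xk≡m (mono-≤ k≤i))
      point : X (m ∷ []) ≡ labelsFrom T₁ T₂ (k ∷ [])
      point = labelsFrom-point _ _ T₁ T₂ m k
                (trans (cong (_∈ᵗ mapT x T₁) (sym xk≡m)) (∈ᵗ-image k T₁))
                (trans (cong (_∈ᵗ mapT x T₂) (sym xk≡m)) (∈ᵗ-image k T₂))

place : ℕ → List ℕ → ℕ → ℕ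
place n [] i = i + n
place n (p ∷ ps) zero = p
place n (p ∷ ps) (suc i) = place n ps i

place-increasing : ∀ n ps → Linked _<_ (ps ∷ʳ n) → StrictlyIncreasing (place n ps)
place-increasing n [] _ i = ≤-refl
place-increasing n (p ∷ []) (p<n ∷ _) zero = p<n
place-increasing n (p ∷ q ∷ ps) (p<q ∷ _) zero = p<q
place-increasing n (p ∷ ps) ascending (suc i) = place-increasing n ps (tail ascending) i

place-length : ∀ n ps → place n ps (length ps) ≡ n
place-length n [] = refl
place-length n (p ∷ ps) = place-length n ps

-- The configuration of two triangles on increasing points p₀ < p₁ < … < n can be
-- read off from the index patterns of their vertices.
labels-place : ∀ n ps → Linked _<_ (ps ∷ʳ n) → ∀ T₁ T₂
             → labels n (mapT (place n ps) T₁) (mapT (place n ps) T₂) ≡ labelsFrom T₁ T₂ (upTo (length ps))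
labels-place n ps ascending T₁ T₂ = labels-image T₁ T₂ n (length ps) below above
  where
  open Relabel (place n ps) (place-increasing n ps ascending)
  below : ∀ i → i < length ps → place n ps i < n
  below i i<len = subst (place n ps i <_) (place-length n ps) (mono-< i<len)
  above : ∀ i → length ps ≤ i → n ≤ place n ps i
  above i len≤i = subst (_≤ place n ps i) (place-length n ps) (mono-≤ len≤i)

module _ {n a b c : ℕ} where

  ears : ∀ {a′ b′ c′} → a < b → b < a′ → a′ < b′ → b′ < c′ → c′ < c → c < n
       → Forbidden n (a , b , c) (a′ , b′ , c′)
  ears {a′} {b′} {c′} h₁ h₂ h₃ h₄ h₅ h₆ = inj₂ (inj₁ (5 , inj₁ (cong (rotate 5)
    (labels-place n (a ∷ b ∷ a′ ∷ b′ ∷ c′ ∷ c ∷ []) (h₁ ∷ h₂ ∷ h₃ ∷ h₄ ∷ h₅ ∷ h₆ ∷ [-]) (0 , 1 , 5) (2 , 3 , 4)))))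

  david : ∀ {a′ b′ c′} → a < a′ → a′ < b → b < b′ → b′ < c → c < c′ → c′ < n
        → Forbidden n (a , b , c) (a′ , b′ , c′)
  david {a′} {b′} {c′} h₁ h₂ h₃ h₄ h₅ h₆ = inj₂ (inj₂ (0 , inj₁ (cong (rotate 0)
    (labels-place n (a ∷ a′ ∷ b ∷ b′ ∷ c ∷ c′ ∷ []) (h₁ ∷ h₂ ∷ h₃ ∷ h₄ ∷ h₅ ∷ h₆ ∷ [-]) (0 , 2 , 4) (1 , 3 , 5)))))

  nested-at-a : ∀ {b′ c′} → a < b → b < b′ → b′ < c′ → c′ < c → c < n
              → Forbidden n (a , b , c) (a , b′ , c′)
  nested-at-a {b′} {c′} h₁ h₂ h₃ h₄ h₅ = inj₁ (0 , inj₁ (cong (rotate 0)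
    (labels-place n (a ∷ b ∷ b′ ∷ c′ ∷ c ∷ []) (h₁ ∷ h₂ ∷ h₃ ∷ h₄ ∷ h₅ ∷ [-]) (0 , 1 , 4) (0 , 2 , 3))))

  nested-at-b : ∀ {a′ c′} → a′ < a → a < b → b < c → c < c′ → c′ < n
              → Forbidden n (a , b , c) (a′ , b , c′)
  nested-at-b {a′} {c′} h₁ h₂ h₃ h₄ h₅ = inj₁ (2 , inj₁ (cong (rotate 2)
    (labels-place n (a′ ∷ a ∷ b ∷ c ∷ c′ ∷ []) (h₁ ∷ h₂ ∷ h₃ ∷ h₄ ∷ h₅ ∷ [-]) (1 , 2 , 3) (0 , 2 , 4))))

  nested-at-c : ∀ {a′ b′} → a < a′ → a′ < b′ → b′ < b → b < c → c < n
              → Forbidden n (a , b , c) (a′ , b′ , c)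
  nested-at-c {a′} {b′} h₁ h₂ h₃ h₄ h₅ = inj₁ (4 , inj₁ (cong (rotate 4)
    (labels-place n (a ∷ a′ ∷ b′ ∷ b ∷ c ∷ []) (h₁ ∷ h₂ ∷ h₃ ∷ h₄ ∷ h₅ ∷ [-]) (0 , 3 , 4) (1 , 2 , 4))))

AtMostTwoPerKey : {A : Set} → (A → ℕ) → List A → Set
AtMostTwoPerKey f xs = ∀ {x y z} → x ∈ xs → y ∈ xs → z ∈ xs
                     → x ≢ y → x ≢ z → y ≢ z → f x ≡ f y → f x ≡ f z → ⊥

length-filter-split : ∀ {A : Set} {P : Pred A 0ℓ} (P? : Decidable P) (xs : List A)
                    → length xs ≡ length (filter P? xs) + length (filter (¬? ∘ P?) xs)
length-filter-split P? [] = refl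
length-filter-split P? (x ∷ xs) with P? x
... | yes _ = cong suc (length-filter-split P? xs)
... | no  _ = trans (cong suc (length-filter-split P? xs)) (sym (+-suc _ _))

fibre-length : ∀ {A : Set} {f : A → ℕ} {xs : List A} {m} → AtMostTwoPerKey f xs
             → (ys : List A) → Unique ys → (∀ {y} → y ∈ ys → y ∈ xs × f y ≡ m) → length ys ≤ 2
fibre-length two [] _ _ = z≤n
fibre-length two (_ ∷ []) _ _ = s≤s z≤n
fibre-length two (_ ∷ _ ∷ []) _ _ = s≤s (s≤s z≤n)
fibre-length two (y₁ ∷ y₂ ∷ y₃ ∷ _) ((y₁≢y₂ ∷ y₁≢y₃ ∷ _) ∷ (y₂≢y₃ ∷ _) ∷ _) in-fibre =
  ⊥-elim (two (proj₁ p₁) (proj₁ p₂) (proj₁ p₃) y₁≢y₂ y₁≢y₃ y₂≢y₃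
              (trans (proj₂ p₁) (sym (proj₂ p₂))) (trans (proj₂ p₁) (sym (proj₂ p₃))))
  where
  p₁ = in-fibre (here refl)
  p₂ = in-fibre (there (here refl))
  p₃ = in-fibre (there (there (here refl)))

length-≤-twice-keys : ∀ {A : Set} (f : A → ℕ) (N : ℕ) (xs : List A) → Unique xs
                    → (∀ {x} → x ∈ xs → f x < N) → AtMostTwoPerKey f xs → length xs ≤ 2 * N
length-≤-twice-keys f zero [] _ _ _ = z≤n
length-≤-twice-keys f zero (x ∷ _) _ key<0 _ = ⊥-elim (n≮0 (key<0 (here refl)))
length-≤-twice-keys {A} f (suc N) xs unique key< two = begin
    length xs                              ≡⟨ length-filter-split top? xs ⟩
    length (filter top? xs) + length rest  ≤⟨ +-mono-≤ top-fibre rest-bound ⟩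
    2 + 2 * N                              ≡⟨ sym (*-suc 2 N) ⟩
    2 * suc N                              ∎
  where
  open ≤-Reasoning
  top? : Decidable (λ x → f x ≡ N)
  top? x = f x ≟ N
  rest : List A
  rest = filter (¬? ∘ top?) xs
  in-rest : ∀ {x} → x ∈ rest → x ∈ xs × f x ≢ N
  in-rest = ∈-filter⁻ (¬? ∘ top?)
  top-fibre : length (filter top? xs) ≤ 2
  top-fibre = fibre-length two (filter top? xs) (Unique.filter⁺ top? unique) (∈-filter⁻ top?)
  rest-bound : length rest ≤ 2 * N
  rest-bound = length-≤-twice-keys f N rest (Unique.filter⁺ (¬? ∘ top?) unique)
    (λ m → ≤∧≢⇒< (≤-pred (key< (proj₁ (in-rest m)))) (proj₂ (in-rest m)))
    (λ mx my mz → two (proj₁ (in-rest mx)) (proj₁ (in-rest my)) (proj₁ (in-rest mz)))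

Abut : ℕ × ℕ → ℕ × ℕ → Set
Abut (a , b) (a′ , b′) = b ≡ a′ ⊎ b′ ≡ a

no-three-abutting : ∀ {a₁ b₁ a₂ b₂ a₃ b₃} → a₁ < b₁ → a₂ < b₂ → a₃ < b₃
                  → Abut (a₁ , b₁) (a₂ , b₂) → Abut (a₁ , b₁) (a₃ , b₃) → Abut (a₂ , b₂) (a₃ , b₃) → ⊥
no-three-abutting p₁ p₂ p₃ (inj₁ refl) (inj₁ refl) (inj₁ refl) = <-irrefl refl p₂
no-three-abutting p₁ p₂ p₃ (inj₁ refl) (inj₁ refl) (inj₂ refl) = <-irrefl refl p₃
no-three-abutting p₁ p₂ p₃ (inj₁ refl) (inj₂ refl) (inj₁ refl) = <-irrefl refl (<-trans p₃ (<-trans p₁ p₂))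
no-three-abutting p₁ p₂ p₃ (inj₁ refl) (inj₂ refl) (inj₂ refl) = <-irrefl refl p₁
no-three-abutting p₁ p₂ p₃ (inj₂ refl) (inj₁ refl) (inj₁ refl) = <-irrefl refl p₁
no-three-abutting p₁ p₂ p₃ (inj₂ refl) (inj₁ refl) (inj₂ refl) = <-irrefl refl (<-trans p₂ (<-trans p₁ p₃))
no-three-abutting p₁ p₂ p₃ (inj₂ refl) (inj₂ refl) (inj₁ refl) = <-irrefl refl p₃
no-three-abutting p₁ p₂ p₃ (inj₂ refl) (inj₂ refl) (inj₂ refl) = <-irrefl refl p₂

no-three-distinct : (Q : ℕ → Set) → (∀ {x y z} → Q x → Q y → Q z → x < y → y < z → ⊥)
                  → ∀ {x y z} → Q x → Q y → Q z → x ≢ y → x ≢ z → y ≢ z → ⊥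
no-three-distinct Q sorted {x} {y} {z} qx qy qz x≢y x≢z y≢z with <-cmp x y | <-cmp x z | <-cmp y z
... | tri≈ _ x≡y _ | _ | _ = x≢y x≡y
... | _ | tri≈ _ x≡z _ | _ = x≢z x≡z
... | _ | _ | tri≈ _ y≡z _ = y≢z y≡z
... | tri< x<y _ _ | _            | tri< y<z _ _ = sorted qx qy qz x<y y<z
... | tri< x<y _ _ | tri< x<z _ _ | tri> _ _ z<y = sorted qx qz qy x<z z<y
... | tri< x<y _ _ | tri> _ _ z<x | tri> _ _ z<y = sorted qz qx qy z<x x<y
... | tri> _ _ y<x | tri< x<z _ _ | _            = sorted qy qx qz y<x x<z
... | tri> _ _ y<x | tri> _ _ z<x | tri< y<z _ _ = sorted qy qz qx y<z z<x
... | tri> _ _ y<x | _            | tri> _ _ z<y = sorted qz qy qx z<y y<x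

tag : ℕ → Bool → ℕ → ℕ
tag N true  v = N + v
tag N false v = v

tag-< : ∀ {N v} f → v < N → tag N f v < 2 * N
tag-< {N} {v} true  v<N = subst (N + v <_) (cong (N +_) (sym (+-identityʳ N))) (+-monoʳ-< N v<N)
tag-< {N} false v<N = <-≤-trans v<N (m≤m+n N (N + 0))

tag-injective : ∀ {N v v′} f f′ → v < N → v′ < N → tag N f v ≡ tag N f′ v′ → f ≡ f′ × v ≡ v′
tag-injective {N} true  true  _   _    e = refl , +-cancelˡ-≡ N _ _ e
tag-injective     false false _   _    e = refl , e
tag-injective {N} true  false _   v′<N e = ⊥-elim (<⇒≢ (<-≤-trans v′<N (m≤m+n N _)) (sym e))
tag-injective {N} false true  v<N _    e = ⊥-elim (<⇒≢ (<-≤-trans v<N (m≤m+n N _)) e)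

module Family (n : ℕ) (F : List Tri) (admissible : Admissible n F) where

  shape : ∀ {t} → t ∈ F → TopBottomTri n t
  shape = All.lookup (proj₁ (proj₂ admissible))

  compatible : ∀ {t t′} → t ∈ F → t′ ∈ F → t ≢ t′ → ¬ Forbidden n t t′
  compatible = proj₂ (proj₂ admissible)

  module _ {a b c : ℕ} (t : (a , b , c) ∈ F) where
    a<b : a < b
    a<b = proj₁ (proj₁ (shape t))
    b<c : b < c
    b<c = proj₁ (proj₂ (proj₁ (shape t)))
    c<n : c < n
    c<n = proj₂ (proj₂ (proj₁ (shape t)))
    b<n : b < n
    b<n = <-trans b<c c<n
    a<n : a < n
    a<n = <-trans a<b b<n

  top<bottom : ∀ {a b c a′ b′ c′} → (a , b , c) ∈ F → (a′ , b′ , c′) ∈ F → b < c′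
  top<bottom t t′ = <-≤-trans (proj₁ (proj₂ (proj₂ (shape t)))) (proj₂ (proj₂ (proj₂ (shape t′))))

  differ-a : ∀ {a b c a′ b′ c′} → a ≢ a′ → _≢_ {A = Tri} (a , b , c) (a′ , b′ , c′)
  differ-a a≢a′ = a≢a′ ∘ cong proj₁

  differ-b : ∀ {a b c a′ b′ c′} → b ≢ b′ → _≢_ {A = Tri} (a , b , c) (a′ , b′ , c′)
  differ-b b≢b′ = b≢b′ ∘ cong (proj₁ ∘ proj₂)

  no-nested-at-c : ∀ {a b c a′ b′} → (a , b , c) ∈ F → (a′ , b′ , c) ∈ F → a < a′ → b′ < b → ⊥
  no-nested-at-c t t′ a<a′ b′<b =
    compatible t t′ (differ-a (<⇒≢ a<a′)) (nested-at-c a<a′ (a<b t′) b′<b (b<c t) (c<n t))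

  no-ears : ∀ {a b c a′ b′ c′} → (a , b , c) ∈ F → (a′ , b′ , c′) ∈ F → b < a′ → c′ < c → ⊥
  no-ears t t′ b<a′ c′<c =
    compatible t t′ (differ-a (<⇒≢ (<-trans (a<b t) b<a′))) (ears (a<b t) b<a′ (a<b t′) (b<c t′) c′<c (c<n t))

  no-david : ∀ {a b c a′ b′ c′} → (a , b , c) ∈ F → (a′ , b′ , c′) ∈ F
           → a < a′ → a′ < b → b < b′ → c < c′ → ⊥
  no-david t t′ a<a′ a′<b b<b′ c<c′ =
    compatible t t′ (differ-a (<⇒≢ a<a′)) (david a<a′ a′<b b<b′ (top<bottom t′ t) c<c′ (c<n t′))

  no-nested-at-a : ∀ {a b c b′ c′} → (a , b , c) ∈ F → (a , b′ , c′) ∈ F → b < b′ → c′ < c → ⊥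
  no-nested-at-a t t′ b<b′ c′<c =
    compatible t t′ (differ-b (<⇒≢ b<b′)) (nested-at-a (a<b t) b<b′ (b<c t′) c′<c (c<n t))

  no-nested-at-b : ∀ {a b c a′ c′} → (a , b , c) ∈ F → (a′ , b , c′) ∈ F → a′ < a → c < c′ → ⊥
  no-nested-at-b t t′ a′<a c<c′ =
    compatible t t′ (differ-a (<⇒≢ a′<a ∘ sym)) (nested-at-b a′<a (a<b t) (b<c t) c<c′ (c<n t′))

  Some : (Tri → Set) → Set
  Some P = ∃[ t ] (t ∈ F × P t)

  some? : ∀ {P : Tri → Set} → Decidable P → Dec (Some P)
  some? P? = map′ find (λ (_ , t∈F , p) → lose t∈F p) (any? P? F)

  Lower Higher Longer : Tri → Tri → Set
  Lower  (a , b , c) (a′ , b′ , c′) = a′ ≡ a × b′ ≡ b × c′ < c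
  Higher (a , b , c) (a′ , b′ , c′) = a′ ≡ a × b′ ≡ b × c < c′
  Longer (a , b , c) (a′ , b′ , c′) = a′ ≡ a × b < b′

  HasLower Inner Extendable : Tri → Set
  HasLower t   = Some (Lower t)
  Inner t      = HasLower t × Some (Higher t)
  Extendable t = Some (Longer t)

  hasLower? : Decidable HasLower
  hasLower? (a , b , c) = some? λ { (a′ , b′ , c′) → (a′ ≟ a) ×-dec (b′ ≟ b) ×-dec (c′ <? c) }

  inner? : Decidable Inner
  inner? t@(a , b , c) =
    hasLower? t ×-dec some? λ { (a′ , b′ , c′) → (a′ ≟ a) ×-dec (b′ ≟ b) ×-dec (c <? c′) }

  extendable? : Decidable Extendable
  extendable? (a , b , c) = some? λ { (a′ , b′ , c′) → (a′ ≟ a) ×-dec (b <? b′) }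

  lowerBit : Tri → Bool
  lowerBit t = ⌊ hasLower? t ⌋

  -- Of two triangles on one top pair, if the lower one is outer, it has no lower
  -- neighbour while the higher one has; so their lower bits differ.
  lowerBit-< : ∀ {a b c c′} → (a , b , c) ∈ F → (a , b , c′) ∈ F → ¬ Inner (a , b , c) → c < c′
             → lowerBit (a , b , c) ≢ lowerBit (a , b , c′)
  lowerBit-< {a} {b} {c} {c′} t t′ outer c<c′ same = false≢true (begin
      false                  ≡⟨ sym (⌊⌋-false (hasLower? _) (λ low → outer (low , higher))) ⟩
      lowerBit (a , b , c)   ≡⟨ same ⟩
      lowerBit (a , b , c′)  ≡⟨ ⌊⌋-true (hasLower? _) (_ , t , refl , refl , c<c′) ⟩
      true                   ∎)
    where
    open ≡-Reasoning
    higher : Some (Higher (a , b , c))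
    higher = (_ , t′ , refl , refl , c<c′)
    false≢true : false ≢ true
    false≢true ()

  outer-determined : ∀ {a b c c′} → (a , b , c) ∈ F → (a , b , c′) ∈ F → ¬ Inner (a , b , c) → ¬ Inner (a , b , c′)
                   → lowerBit (a , b , c) ≡ lowerBit (a , b , c′) → c ≡ c′
  outer-determined {c = c} {c′} t t′ outer outer′ same with <-cmp c c′
  ... | tri< c<c′ _ _ = ⊥-elim (lowerBit-< t t′ outer c<c′ same)
  ... | tri≈ _ c≡c′ _ = c≡c′
  ... | tri> _ _ c′<c = ⊥-elim (lowerBit-< t′ t outer′ c′<c (sym same))

  inner-touch : ∀ {a b a′ b′ c} → (a , b , c) ∈ F → (a′ , b′ , c) ∈ F
              → Inner (a , b , c) → Inner (a′ , b′ , c) → a < a′ → b ≡ a′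
  inner-touch {b = b} {a′} {b′} t t′
              ((_ , l , refl , refl , l<c) , (_ , h , refl , refl , c<h))
              ((_ , l′ , refl , refl , l′<c) , (_ , h′ , refl , refl , c<h′)) a<a′ with <-cmp b a′
  ... | tri< b<a′ _ _ = ⊥-elim (no-ears h l′ b<a′ (<-trans l′<c c<h))
  ... | tri≈ _ b≡a′ _ = b≡a′
  ... | tri> _ _ a′<b with <-cmp b b′
  ... | tri< b<b′ _ _ = ⊥-elim (no-david l h′ a<a′ a′<b b<b′ (<-trans l<c c<h′))
  ... | tri≈ _ refl _ = ⊥-elim (no-nested-at-b l′ h a<a′ (<-trans l′<c c<h))
  ... | tri> _ _ b′<b = ⊥-elim (no-nested-at-c t t′ a<a′ b′<b)

  inner-same-first : ∀ {a b b′ c} → (a , b , c) ∈ F → (a , b′ , c) ∈ F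
                   → Inner (a , b , c) → Inner (a , b′ , c) → b ≡ b′
  inner-same-first {b = b} {b′} t t′
                   ((_ , l , refl , refl , l<c) , (_ , h , refl , refl , c<h))
                   ((_ , l′ , refl , refl , l′<c) , (_ , h′ , refl , refl , c<h′)) with <-cmp b b′
  ... | tri< b<b′ _ _ = ⊥-elim (no-nested-at-a h l′ b<b′ (<-trans l′<c c<h))
  ... | tri≈ _ b≡b′ _ = b≡b′
  ... | tri> _ _ b′<b = ⊥-elim (no-nested-at-a h′ l b′<b (<-trans l<c c<h′))

  inner-abut : ∀ {a b a′ b′ c} → (a , b , c) ∈ F → (a′ , b′ , c) ∈ F → Inner (a , b , c) → Inner (a′ , b′ , c)
             → _≢_ {A = Tri} (a , b , c) (a′ , b′ , c) → Abut (a , b) (a′ , b′)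
  inner-abut {a} {b} {a′} {c = c} t t′ i i′ t≢t′ with <-cmp a a′
  ... | tri< a<a′ _ _ = inj₁ (inner-touch t t′ i i′ a<a′)
  ... | tri≈ _ refl _ = ⊥-elim (t≢t′ (cong (λ b′ → a , b′ , c) (inner-same-first t t′ i i′)))
  ... | tri> _ _ a′<a = inj₂ (inner-touch t′ t i′ i a′<a)

  extension-pinned : ∀ {a a′ b c c′ q d} → (a , b , c) ∈ F → (a′ , b , c′) ∈ F → (a′ , q , d) ∈ F
                   → b < q → a < a′ → d ≡ c′ × c ≡ c′
  extension-pinned {c = c} {c′} {d = d} t t′ e b<q a<a′ = ≤-antisym (≤-trans d≤c c≤c′) c′≤d , ≤-antisym c≤c′ (≤-trans c′≤d d≤c)
    where
    d≤c : d ≤ c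
    d≤c = ≮⇒≥ (λ c<d → no-david t e a<a′ (a<b t′) b<q c<d)
    c≤c′ : c ≤ c′
    c≤c′ = ≮⇒≥ (λ c′<c → no-nested-at-b t′ t a<a′ c′<c)
    c′≤d : c′ ≤ d
    c′≤d = ≮⇒≥ (λ d<c′ → no-nested-at-a t′ e b<q d<c′)

  no-three-extendable : ∀ {a₁ a₂ a₃ b c₁ c₂ c₃} → (a₁ , b , c₁) ∈ F → (a₂ , b , c₂) ∈ F → (a₃ , b , c₃) ∈ F
                      → Extendable (a₂ , b , c₂) → Extendable (a₃ , b , c₃) → a₁ < a₂ → a₂ < a₃ → ⊥
  no-three-extendable {a₃ = a₃} {b} {c₃ = c₃} t₁ t₂ t₃ ((_ , _ , d₂) , e₂ , refl , b<q₂) (_ , e₃ , refl , b<q₃) a₁<a₂ a₂<a₃ =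
    no-nested-at-c e₂ t₃′ a₂<a₃ b<q₂
    where
    d₂≡c₃ : d₂ ≡ c₃
    d₂≡c₃ = trans (proj₁ (extension-pinned t₁ t₂ e₂ b<q₂ a₁<a₂)) (proj₂ (extension-pinned t₂ t₃ e₃ b<q₃ a₂<a₃))
    t₃′ : (a₃ , b , d₂) ∈ F
    t₃′ = subst (λ z → (a₃ , b , z) ∈ F) (sym d₂≡c₃) t₃

  outer-distinct-first : ∀ {a a′ b c c′} → (a , b , c) ∈ F → (a′ , b , c′) ∈ F
                       → ¬ Inner (a , b , c) → ¬ Inner (a′ , b , c′) → lowerBit (a , b , c) ≡ lowerBit (a′ , b , c′)
                       → _≢_ {A = Tri} (a , b , c) (a′ , b , c′) → a ≢ a′
  outer-distinct-first {a} {b = b} t t′ outer outer′ same t≢t′ refl =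
    t≢t′ (cong (λ z → a , b , z) (outer-determined t t′ outer outer′ same))

  innerTriangles outerTriangles cappedTriangles extendedTriangles : List Tri
  innerTriangles    = filter inner? F
  outerTriangles    = filter (¬? ∘ inner?) F
  extendedTriangles = filter extendable? outerTriangles
  cappedTriangles   = filter (¬? ∘ extendable?) outerTriangles

  ∈-inner : ∀ {t} → t ∈ innerTriangles → t ∈ F × Inner t
  ∈-inner = ∈-filter⁻ inner?

  ∈-outer : ∀ {t} → t ∈ outerTriangles → t ∈ F × ¬ Inner t
  ∈-outer = ∈-filter⁻ (¬? ∘ inner?)

  ∈-extended : ∀ {t} → t ∈ extendedTriangles → (t ∈ F × ¬ Inner t) × Extendable t
  ∈-extended m = let (o , x) = ∈-filter⁻ extendable? m in ∈-outer o , x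

  ∈-capped : ∀ {t} → t ∈ cappedTriangles → (t ∈ F × ¬ Inner t) × ¬ Extendable t
  ∈-capped m = let (o , x) = ∈-filter⁻ (¬? ∘ extendable?) m in ∈-outer o , x

  unique-outer : Unique outerTriangles
  unique-outer = Unique.filter⁺ (¬? ∘ inner?) (proj₁ admissible)

  inner-count : length innerTriangles ≤ 2 * n
  inner-count = length-≤-twice-keys bottom n innerTriangles (Unique.filter⁺ inner? (proj₁ admissible))
                                    (λ m → c<n (proj₁ (∈-inner m))) at-most-two
    where
    bottom : Tri → ℕ
    bottom t = proj₂ (proj₂ t)
    at-most-two : AtMostTwoPerKey bottom innerTriangles
    at-most-two {_ , _ , _} {_ , _ , _} {_ , _ , _} m₁ m₂ m₃ t₁≢t₂ t₁≢t₃ t₂≢t₃ refl refl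
      with ∈-inner m₁ | ∈-inner m₂ | ∈-inner m₃
    ... | t₁ , i₁ | t₂ , i₂ | t₃ , i₃ =
      no-three-abutting (a<b t₁) (a<b t₂) (a<b t₃)
        (inner-abut t₁ t₂ i₁ i₂ t₁≢t₂) (inner-abut t₁ t₃ i₁ i₃ t₁≢t₃) (inner-abut t₂ t₃ i₂ i₃ t₂≢t₃)

  -- Capped triangles, keyed by (lower bit, first vertex): the key is injective,
  -- since the second vertex of a capped triangle is the largest one at its first vertex.
  cappedKey : Tri → ℕ
  cappedKey t = tag n (lowerBit t) (proj₁ t)

  capped-injective : ∀ {t t′} → t ∈ cappedTriangles → t′ ∈ cappedTriangles → cappedKey t ≡ cappedKey t′ → t ≡ t′
  capped-injective {a , b , c} {a′ , b′ , c′} m m′ same with ∈-capped m | ∈-capped m′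
  ... | (t , outer) , capped | (t′ , outer′) , capped′
    with tag-injective (lowerBit (a , b , c)) (lowerBit (a′ , b′ , c′)) (a<n t) (a<n t′) same
  ... | same-bit , refl with <-cmp b b′
  ... | tri< b<b′ _ _ = ⊥-elim (capped (_ , t′ , refl , b<b′))
  ... | tri≈ _ refl _ = cong (λ z → a , b , z) (outer-determined t t′ outer outer′ same-bit)
  ... | tri> _ _ b′<b = ⊥-elim (capped′ (_ , t , refl , b′<b))

  capped-count : length cappedTriangles ≤ 2 * (2 * n)
  capped-count = length-≤-twice-keys cappedKey (2 * n) cappedTriangles
    (Unique.filter⁺ (¬? ∘ extendable?) unique-outer)
    (λ {t} m → tag-< (lowerBit t) (a<n (proj₁ (proj₁ (∈-capped m)))))
    (λ m₁ m₂ _ t₁≢t₂ _ _ same _ → t₁≢t₂ (capped-injective m₁ m₂ same))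

  -- Extendable outer triangles, keyed by (lower bit, second vertex): triangles with
  -- one key have distinct first vertices, and no three of them can exist.
  extendedKey : Tri → ℕ
  extendedKey t = tag n (lowerBit t) (proj₁ (proj₂ t))

  extended-at-most-two : AtMostTwoPerKey extendedKey extendedTriangles
  extended-at-most-two {a₁ , b , c₁} {a₂ , b₂ , c₂} {a₃ , b₃ , c₃} m₁ m₂ m₃ t₁≢t₂ t₁≢t₃ t₂≢t₃ same₁₂ same₁₃
    with ∈-extended m₁ | ∈-extended m₂ | ∈-extended m₃
  ... | (t₁ , o₁) , x₁ | (t₂ , o₂) , x₂ | (t₃ , o₃) , x₃
    with tag-injective (lowerBit (a₁ , b , c₁)) (lowerBit (a₂ , b₂ , c₂)) (b<n t₁) (b<n t₂) same₁₂
       | tag-injective (lowerBit (a₁ , b , c₁)) (lowerBit (a₃ , b₃ , c₃)) (b<n t₁) (b<n t₃) same₁₃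
  ... | bit₁₂ , refl | bit₁₃ , refl =
    no-three-distinct ExtendableAt (λ (_ , t₁ , _) (_ , t₂ , x₂) (_ , t₃ , x₃) → no-three-extendable t₁ t₂ t₃ x₂ x₃)
      (_ , t₁ , x₁) (_ , t₂ , x₂) (_ , t₃ , x₃)
      (outer-distinct-first t₁ t₂ o₁ o₂ bit₁₂ t₁≢t₂)
      (outer-distinct-first t₁ t₃ o₁ o₃ bit₁₃ t₁≢t₃)
      (outer-distinct-first t₂ t₃ o₂ o₃ (trans (sym bit₁₂) bit₁₃) t₂≢t₃)
    where
    ExtendableAt : ℕ → Set
    ExtendableAt a = ∃[ c ] ((a , b , c) ∈ F × Extendable (a , b , c))

  extended-count : length extendedTriangles ≤ 2 * (2 * n)
  extended-count = length-≤-twice-keys extendedKey (2 * n) extendedTriangles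
    (Unique.filter⁺ extendable? unique-outer)
    (λ {t} m → tag-< (lowerBit t) (b<n (proj₁ (proj₁ (∈-extended m)))))
    extended-at-most-two

  size-bound : length F ≤ 10 * n
  size-bound = begin
      length F                                                              ≡⟨ length-filter-split inner? F ⟩
      length innerTriangles + length outerTriangles                         ≡⟨ cong (length innerTriangles +_)
                                                                               (length-filter-split extendable? outerTriangles) ⟩
      length innerTriangles + (length extendedTriangles + length cappedTriangles)
        ≤⟨ +-mono-≤ inner-count (+-mono-≤ extended-count capped-count) ⟩
      2 * n + (2 * (2 * n) + 2 * (2 * n))                                   ≡⟨ arithmetic n ⟩
      10 * n                                                                ∎
    where
    open ≤-Reasoning
    open +-*-Solver using (solve; _:+_; _:*_; _:=_; con)
    arithmetic : ∀ m → 2 * m + (2 * (2 * m) + 2 * (2 * m)) ≡ 10 * m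
    arithmetic = solve 1 (λ m → con 2 :* m :+ (con 2 :* (con 2 :* m) :+ con 2 :* (con 2 :* m)) := con 10 :* m) refl

theorem10 : ∃[ C ] ∃[ N ] (∀ (n : ℕ) → N ≤ n → (F : List Tri) → Admissible n F → length F ≤ C * n)
theorem10 = 10 , 0 , λ n _ F admissible → Family.size-bound n F admissible
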